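{- Let $G$ be an $n$-vertex graph and let $\phi$ be an optimal ordering of $G$ (i.e., $\phi$ minimizes $\mu_G$). Then the sequence $rd_\phi(\phi^{ -1}(1)), rd_\phi(\phi^{ -1}(2)),\dots, rd_\phi(\phi^{ -1}(n))$ of right degrees is non-increasing.
   Context: All graphs are finite and simple. For an $n$-vertex graph $G$, an ordering is a bijection $\phi:V(G)\to[n]$; its cost is $\mu_G(\phi)=\sum_{\{u,v\}\in E(G)}\min\{\phi(u),\phi(v)\}$, and $\phi$ is optimal if it minimizes $\mu_G$ over all orderings. The right degree of a vertex $v$ in $\phi$ is $rd_\phi(v)=|\{u\in N_G(v):\phi(u)>\phi(v)\}|$. -}

module Defs where

open import Data.Nat using (ℕ; zero; suc; _+_; _*_; _⊔_; _⊓_; _≤_; _<_)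
open import Data.Nat.Properties using (_<?_)
open import Data.Bool using (Bool; true; false; T)
open import Data.Bool.Properties using (T?)
open import Data.Fin using (Fin; toℕ)
open import Data.Fin.Properties using (<-cmp)
open import Data.Nat.ListAction using (sum)
open import Data.List using (List; map; filter; length; allFin; concatMap)
open import Data.Product using (_×_; _,_)
open import Relation.Nullary using (¬_; Dec; yes; no)
open import Relation.Binary.PropositionalEquality using (_≡_)
open import Function.Bundles using (_↔_; Inverse)

record Graph (n : ℕ) : Set where
  field
    adj    : Fin n → Fin n → Bool
    sym    : ∀ u v → adj u v ≡ adj v u
    loopless : ∀ v → adj v v ≡ false
open Graph public

-- An ordering is a bijection V(G) → [n].  We identify [n] with Fin n,
-- position of vertex v being  toℕ (φ v) + 1  (so positions are 1..n).
Ordering : ℕ → Set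
Ordering n = Fin n ↔ Fin n

pos : ∀ {n} → Ordering n → Fin n → ℕ
pos φ v = suc (toℕ (Inverse.to φ v))

vertexAt : ∀ {n} → Ordering n → Fin n → Fin n
vertexAt φ i = Inverse.from φ i

-- Each unordered edge {u,v} counted once, via u < v (as Fin indices).
edgeCostTerm : ∀ {n} → Graph n → Ordering n → Fin n → Fin n → ℕ
edgeCostTerm G φ u v with toℕ u <? toℕ v | adj G u v
... | yes _ | true  = pos φ u ⊓ pos φ v
... | _     | _     = 0

cost : ∀ {n} → Graph n → Ordering n → ℕ
cost {n} G φ = sum (concatMap (λ u → map (λ v → edgeCostTerm G φ u v) (allFin n)) (allFin n))

Optimal : ∀ {n} → Graph n → Ordering n → Set
Optimal {n} G φ = ∀ (ψ : Ordering n) → cost G φ ≤ cost G ψ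

rightDegree : ∀ {n} → Graph n → Ordering n → Fin n → ℕ
rightDegree {n} G φ v =
  length (filter (λ u → pos φ v <? pos φ u) (filter (λ u → T? (adj G v u)) (allFin n)))

-- Let a and b be the vertices at consecutive positions p and p + 1 of an
-- ordering, and swap them.  The only edges whose minimum position changes
-- are those from a or b to vertices further right: each such edge at a
-- gains one, each such edge at b loses one.  Hence the cost changes by
-- (rd a - [ab ∈ E]) - rd b, and optimality forces rd b ≤ rd a.  Chaining
-- over consecutive positions gives the whole sequence.

module Submission where

open import Defs hiding (sym)
open import Data.Nat using (ℕ; _≤_)
open import Data.Fin using (Fin; toℕ)

open import Data.Nat.Base using (zero; suc; _+_; _*_; _∸_; _⊓_; _<_; _≡ᵇ_; _<ᵇ_; z≤n; s≤s)
open import Data.Nat.Properties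
open import Data.Bool.Base using (Bool; true; false; _∧_; if_then_else_)
open import Data.Bool.Properties using (∧-zeroʳ)
open import Data.Fin.Base as Fin using (fromℕ<; punchIn)
open import Data.Fin.Properties using (toℕ-injective; toℕ-fromℕ<; toℕ<n; punchInᵢ≢i)
  renaming (_≟_ to _≟ᶠ_)
import Data.Fin.Permutation as Perm
import Data.Fin.Permutation.Components as PC
open import Data.Nat.ListAction using (sum)
open import Data.Nat.ListAction.Properties using (sum-++)
open import Data.List.Base using (List; []; _∷_; map; filter; length; allFin; concatMap; tabulate)
open import Data.List.Properties using (map-tabulate)
open import Algebra.Properties.CommutativeMonoid.Sum +-0-commutativeMonoid
  using (sum-syntax; ∑-distrib-+; ∑-comm; sum-cong-≗; sum-remove; sum-replicate-zero)
  renaming (sum to ∑)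
open import Relation.Binary.PropositionalEquality
open import Relation.Binary.Definitions using (tri<; tri≈; tri>)
open import Data.Empty using (⊥-elim)
open import Relation.Nullary using (¬_; Dec; yes; no; does)
open import Relation.Nullary.Decidable using (T?; dec-true; dec-false)
open import Function.Base using (_∘_; id; flip)
open import Function.Bundles using (Inverse)

𝟙 : Bool → ℕ
𝟙 true  = 1
𝟙 false = 0

≡ᵇ-refl : ∀ m → (m ≡ᵇ m) ≡ true
≡ᵇ-refl m = dec-true (m ≟ m) refl

≢⇒≡ᵇ-false : ∀ {m n} → m ≢ n → (m ≡ᵇ n) ≡ false
≢⇒≡ᵇ-false {m} {n} = dec-false (m ≟ n)

𝟙-suc-<ᵇ : ∀ p y → 𝟙 (suc p <ᵇ y) ≤ 𝟙 (p <ᵇ y)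
𝟙-suc-<ᵇ p       zero          = z≤n
𝟙-suc-<ᵇ zero    (suc zero)    = z≤n
𝟙-suc-<ᵇ zero    (suc (suc y)) = s≤s z≤n
𝟙-suc-<ᵇ (suc p) (suc y)       = 𝟙-suc-<ᵇ p y

∑-zero : ∀ {n} (f : Fin n → ℕ) → (∀ i → f i ≡ 0) → ∑ f ≡ 0
∑-zero {n} f f≡0 = trans (sum-cong-≗ f≡0) (sum-replicate-zero n)

∑-pointMass : ∀ {n} (f : Fin n → ℕ) (x : Fin n) → (∀ i → i ≢ x → f i ≡ 0) → ∑ f ≡ f x
∑-pointMass {suc n} f x off = begin
  ∑ f                      ≡⟨ sum-remove {i = x} f ⟩
  f x + ∑ (f ∘ punchIn x)  ≡⟨ cong (f x +_) (∑-zero _ (λ i → off _ (punchInᵢ≢i x i))) ⟩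
  f x + 0                  ≡⟨ +-identityʳ (f x) ⟩
  f x                      ∎
  where open ≡-Reasoning

∑-mono-≤ : ∀ {n} {f g : Fin n → ℕ} → (∀ i → f i ≤ g i) → ∑ f ≤ ∑ g
∑-mono-≤ {zero}  f≤g = z≤n
∑-mono-≤ {suc n} f≤g = +-mono-≤ (f≤g Fin.zero) (∑-mono-≤ (f≤g ∘ Fin.suc))

∑∑-cong : ∀ {m n} {f g : Fin m → Fin n → ℕ} → (∀ i j → f i j ≡ g i j) →
          ∑[ i < m ] ∑[ j < n ] f i j ≡ ∑[ i < m ] ∑[ j < n ] g i j
∑∑-cong f≡g = sum-cong-≗ (λ i → sum-cong-≗ (f≡g i))

∑∑-distrib-+ : ∀ {m n} (f g : Fin m → Fin n → ℕ) →
               ∑[ i < m ] ∑[ j < n ] (f i j + g i j) ≡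
               ∑[ i < m ] ∑[ j < n ] f i j + ∑[ i < m ] ∑[ j < n ] g i j
∑∑-distrib-+ f g =
  trans (sum-cong-≗ (λ i → ∑-distrib-+ (f i) (g i))) (∑-distrib-+ (λ i → ∑ (f i)) (λ i → ∑ (g i)))

sum-tabulate : ∀ {n} (f : Fin n → ℕ) → sum (tabulate f) ≡ ∑ f
sum-tabulate {zero}  f = refl
sum-tabulate {suc n} f = cong (f Fin.zero +_) (sum-tabulate (f ∘ Fin.suc))

sum-map-allFin : ∀ {n} (f : Fin n → ℕ) → sum (map f (allFin n)) ≡ ∑ f
sum-map-allFin f = trans (cong sum (map-tabulate id f)) (sum-tabulate f)

sum-concatMap : ∀ {A : Set} (f : A → List ℕ) (xs : List A) →
                sum (concatMap f xs) ≡ sum (map (sum ∘ f) xs)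
sum-concatMap f []       = refl
sum-concatMap f (x ∷ xs) = trans (sum-++ (f x) _) (cong (sum (f x) +_) (sum-concatMap f xs))

length-filter-filter : ∀ {A : Set} {P Q : A → Set} (P? : ∀ x → Dec (P x)) (Q? : ∀ x → Dec (Q x))
                       (xs : List A) →
                       length (filter P? (filter Q? xs)) ≡
                       sum (map (λ x → 𝟙 (does (Q? x)) * 𝟙 (does (P? x))) xs)
length-filter-filter P? Q? [] = refl
length-filter-filter P? Q? (x ∷ xs) with does (Q? x)
... | false = length-filter-filter P? Q? xs
... | true with does (P? x)
...   | false = length-filter-filter P? Q? xs
...   | true  = cong suc (length-filter-filter P? Q? xs)

antitone-from-steps : ∀ {n} (f : Fin n → ℕ) →
                      (∀ k l → toℕ l ≡ suc (toℕ k) → f l ≤ f k) →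
                      ∀ i j → toℕ i ≤ toℕ j → f j ≤ f i
antitone-from-steps {n} f step i j i≤j = go (toℕ j ∸ toℕ i) j (m+[n∸m]≡n i≤j)
  where
  go : ∀ d j → toℕ i + d ≡ toℕ j → f j ≤ f i
  go zero    j i+0≡j = ≤-reflexive (cong f (toℕ-injective (trans (sym i+0≡j) (+-identityʳ (toℕ i)))))
  go (suc d) j i+1+d≡j = ≤-trans (step k j j≡1+k) (go d k (sym (toℕ-fromℕ< i+d<n)))
    where
    1+i+d≡j : suc (toℕ i + d) ≡ toℕ j
    1+i+d≡j = trans (sym (+-suc (toℕ i) d)) i+1+d≡j
    i+d<n : toℕ i + d < n
    i+d<n = ≤-trans (≤-reflexive 1+i+d≡j) (<⇒≤ (toℕ<n j))
    k : Fin n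
    k = fromℕ< i+d<n
    j≡1+k : toℕ j ≡ suc (toℕ k)
    j≡1+k = trans (sym 1+i+d≡j) (cong suc (sym (toℕ-fromℕ< i+d<n)))

module _ {n : ℕ} (G : Graph n) where

  edgeTerm : (Fin n → Fin n → ℕ) → Fin n → Fin n → ℕ
  edgeTerm w u v = 𝟙 (does (toℕ u <? toℕ v) ∧ adj G u v) * w u v

  edgeSum : (Fin n → Fin n → ℕ) → ℕ
  edgeSum w = ∑[ u < n ] ∑[ v < n ] edgeTerm w u v

  edgeTerm-< : ∀ w {u v} → toℕ u < toℕ v → edgeTerm w u v ≡ 𝟙 (adj G u v) * w u v
  edgeTerm-< w {u} {v} u<v = cong (λ b → 𝟙 (b ∧ adj G u v) * w u v) (dec-true (toℕ u <? toℕ v) u<v)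

  edgeTerm-≮ : ∀ w {u v} → ¬ toℕ u < toℕ v → edgeTerm w u v ≡ 0
  edgeTerm-≮ w {u} {v} u≮v = cong (λ b → 𝟙 (b ∧ adj G u v) * w u v) (dec-false (toℕ u <? toℕ v) u≮v)

  edgeSum-+ : ∀ w w′ → edgeSum (λ u v → w u v + w′ u v) ≡ edgeSum w + edgeSum w′
  edgeSum-+ w w′ = trans (∑∑-cong (λ u v → *-distribˡ-+ (𝟙 (does (toℕ u <? toℕ v) ∧ adj G u v)) (w u v) (w′ u v)))
                         (∑∑-distrib-+ (edgeTerm w) (edgeTerm w′))

  edgeSum-cong : ∀ {w w′} → (∀ u v → toℕ u < toℕ v → w u v ≡ w′ u v) → edgeSum w ≡ edgeSum w′
  edgeSum-cong {w} {w′} w≡w′ = ∑∑-cong (λ u v → pointwise u v (toℕ u <? toℕ v))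
    where
    pointwise : ∀ u v → Dec (toℕ u < toℕ v) → edgeTerm w u v ≡ edgeTerm w′ u v
    pointwise u v (yes u<v) = begin
      edgeTerm w u v            ≡⟨ edgeTerm-< w u<v ⟩
      𝟙 (adj G u v) * w u v     ≡⟨ cong (𝟙 (adj G u v) *_) (w≡w′ u v u<v) ⟩
      𝟙 (adj G u v) * w′ u v    ≡⟨ edgeTerm-< w′ u<v ⟨
      edgeTerm w′ u v           ∎
      where open ≡-Reasoning
    pointwise u v (no u≮v) = trans (edgeTerm-≮ w u≮v) (sym (edgeTerm-≮ w′ u≮v))

  adj-split : ∀ w u v → 𝟙 (adj G u v) * w u v ≡ edgeTerm w u v + edgeTerm (flip w) v u
  adj-split w u v with <-cmp (toℕ u) (toℕ v)
  ... | tri< u<v _ v≮u = sym (trans (cong₂ _+_ (edgeTerm-< w u<v) (edgeTerm-≮ (flip w) v≮u)) (+-identityʳ _))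
  ... | tri> u≮v _ v<u = sym (trans (cong₂ _+_ (edgeTerm-≮ w u≮v) (edgeTerm-< (flip w) v<u))
                                    (cong (λ b → 𝟙 b * w u v) (Graph.sym G v u)))
  ... | tri≈ u≮v u≡v v≮u = begin
    𝟙 (adj G u v) * w u v                  ≡⟨ cong (λ b → 𝟙 b * w u v) no-loop ⟩
    0                                      ≡⟨ cong₂ _+_ (edgeTerm-≮ w u≮v) (edgeTerm-≮ (flip w) v≮u) ⟨
    edgeTerm w u v + edgeTerm (flip w) v u ∎
    where
    open ≡-Reasoning
    no-loop : adj G u v ≡ false
    no-loop = subst (λ x → adj G u x ≡ false) (toℕ-injective u≡v) (loopless G u)

  edgeSum-symmetrise : ∀ w → edgeSum (λ u v → w u v + w v u) ≡
                             ∑[ u < n ] ∑[ v < n ] (𝟙 (adj G u v) * w u v)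
  edgeSum-symmetrise w = sym (begin
    ∑[ u < n ] ∑[ v < n ] (𝟙 (adj G u v) * w u v)
      ≡⟨ ∑∑-cong (adj-split w) ⟩
    ∑[ u < n ] ∑[ v < n ] (edgeTerm w u v + edgeTerm (flip w) v u)
      ≡⟨ ∑∑-distrib-+ (edgeTerm w) (λ u v → edgeTerm (flip w) v u) ⟩
    edgeSum w + ∑[ u < n ] ∑[ v < n ] edgeTerm (flip w) v u
      ≡⟨ cong (edgeSum w +_) (∑-comm (λ u v → edgeTerm (flip w) v u)) ⟩
    edgeSum w + edgeSum (flip w)
      ≡⟨ edgeSum-+ w (flip w) ⟨
    edgeSum (λ u v → w u v + w v u) ∎)
    where open ≡-Reasoning

  minPos : Ordering n → Fin n → Fin n → ℕ
  minPos χ u v = pos χ u ⊓ pos χ v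

  cost≡edgeSum : ∀ χ → cost G χ ≡ edgeSum (minPos χ)
  cost≡edgeSum χ = begin
    cost G χ
      ≡⟨ sum-concatMap (λ u → map (edgeCostTerm G χ u) (allFin n)) (allFin n) ⟩
    sum (map (λ u → sum (map (edgeCostTerm G χ u) (allFin n))) (allFin n))
      ≡⟨ sum-map-allFin (λ u → sum (map (edgeCostTerm G χ u) (allFin n))) ⟩
    ∑[ u < n ] sum (map (edgeCostTerm G χ u) (allFin n))
      ≡⟨ sum-cong-≗ (λ u → sum-map-allFin (edgeCostTerm G χ u)) ⟩
    ∑[ u < n ] ∑[ v < n ] edgeCostTerm G χ u v
      ≡⟨ ∑∑-cong edgeCostTerm≡edgeTerm ⟩
    edgeSum (minPos χ) ∎
    where
    open ≡-Reasoning
    edgeCostTerm≡edgeTerm : ∀ u v → edgeCostTerm G χ u v ≡ edgeTerm (minPos χ) u v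
    edgeCostTerm≡edgeTerm u v with toℕ u <? toℕ v
    ... | no u≮v = sym (edgeTerm-≮ (minPos χ) u≮v)
    ... | yes u<v with adj G u v
    ...   | true  = sym (trans (cong (λ b → 𝟙 (b ∧ true) * minPos χ u v) (dec-true (toℕ u <? toℕ v) u<v))
                               (*-identityˡ _))
    ...   | false = sym (cong (λ b → 𝟙 b * minPos χ u v) (∧-zeroʳ (toℕ u <ᵇ toℕ v)))

  rightDegree≡∑ : ∀ χ x → rightDegree G χ x ≡ ∑[ v < n ] (𝟙 (adj G x v) * 𝟙 (pos χ x <ᵇ pos χ v))
  rightDegree≡∑ χ x =
    trans (length-filter-filter (λ v → pos χ x <? pos χ v) (λ v → T? (adj G x v)) (allFin n))
          (sum-map-allFin (λ v → 𝟙 (adj G x v) * 𝟙 (pos χ x <ᵇ pos χ v)))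

transposeSuc : ℕ → ℕ → ℕ
transposeSuc p x = if x ≡ᵇ p then suc p else (if x ≡ᵇ suc p then p else x)

transposeSuc-suc : ∀ p x → transposeSuc (suc p) (suc x) ≡ suc (transposeSuc p x)
transposeSuc-suc p x with x ≡ᵇ p
... | true  = refl
... | false with x ≡ᵇ suc p
...   | true  = refl
...   | false = refl

beyond : ℕ → ℕ → ℕ → ℕ → ℕ
beyond p q x y = 𝟙 ((x ≡ᵇ q) ∧ (suc p <ᵇ y))

-- An edge's gain at p and loss at p + 1 sit on opposite sides, so that no
-- subtraction occurs.
transposeSuc-⊓ : ∀ p x y → x ≢ y →
  suc (transposeSuc p x) ⊓ suc (transposeSuc p y) + (beyond p (suc p) x y + beyond p (suc p) y x) ≡
  suc x ⊓ suc y + (beyond p p x y + beyond p p y x)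
transposeSuc-⊓ (suc p) (suc x) (suc y) x≢y
  rewrite transposeSuc-suc p x | transposeSuc-suc p y = cong suc (transposeSuc-⊓ p x y (x≢y ∘ cong suc))
transposeSuc-⊓ (suc p) zero y _ rewrite ∧-zeroʳ (y ≡ᵇ suc (suc p)) | ∧-zeroʳ (y ≡ᵇ suc p) = refl
transposeSuc-⊓ (suc p) (suc x) zero _
  rewrite ⊓-zeroʳ (transposeSuc (suc p) (suc x)) | ∧-zeroʳ (x ≡ᵇ suc p) | ∧-zeroʳ (x ≡ᵇ p) = refl
transposeSuc-⊓ zero zero          zero          x≢y = ⊥-elim (x≢y refl)
transposeSuc-⊓ zero zero          (suc zero)    _   = refl
transposeSuc-⊓ zero zero          (suc (suc y)) _   = refl
transposeSuc-⊓ zero (suc zero)    zero          _   = refl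
transposeSuc-⊓ zero (suc zero)    (suc zero)    x≢y = ⊥-elim (x≢y refl)
transposeSuc-⊓ zero (suc zero)    (suc (suc y)) _   = refl
transposeSuc-⊓ zero (suc (suc x)) zero          _   = refl
transposeSuc-⊓ zero (suc (suc x)) (suc zero)    _   = refl
transposeSuc-⊓ zero (suc (suc x)) (suc (suc y)) _   = refl

module AdjacentTransposition {n : ℕ} (G : Graph n) (φ : Ordering n)
                             (P Q : Fin n) (Q≡1+P : toℕ Q ≡ suc (toℕ P)) where

  open Inverse φ using (to; from; strictlyInverseˡ; strictlyInverseʳ)

  p : ℕ
  p = toℕ P

  idx : Fin n → ℕ
  idx u = toℕ (to u)

  ψ : Ordering n
  ψ = φ Perm.∘ₚ Perm.transpose P Q

  toℕ-transpose : ∀ k → toℕ (PC.transpose P Q k) ≡ transposeSuc p (toℕ k)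
  toℕ-transpose k with k ≟ᶠ P
  ... | yes refl rewrite ≡ᵇ-refl p = Q≡1+P
  ... | no k≢P with k ≟ᶠ Q
  ...   | yes refl rewrite ≢⇒≡ᵇ-false (k≢P ∘ toℕ-injective) | Q≡1+P | ≡ᵇ-refl p = refl
  ...   | no k≢Q rewrite ≢⇒≡ᵇ-false (k≢P ∘ toℕ-injective)
                       | ≢⇒≡ᵇ-false {toℕ k} (k≢Q ∘ toℕ-injective ∘ (λ e → trans e (sym Q≡1+P))) = refl

  pos-ψ : ∀ u → pos ψ u ≡ suc (transposeSuc p (idx u))
  pos-ψ u = cong suc (toℕ-transpose (to u))

  idx-injective : ∀ {u v} → idx u ≡ idx v → u ≡ v
  idx-injective {u} {v} e =
    trans (sym (strictlyInverseʳ u)) (trans (cong from (toℕ-injective e)) (strictlyInverseʳ v))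

  far : ℕ → Fin n → Fin n → ℕ
  far q u v = beyond p q (idx u) (idx v)

  far↔ : ℕ → Fin n → Fin n → ℕ
  far↔ q u v = far q u v + far q v u

  cost-transposition : cost G ψ + edgeSum G (far↔ (suc p)) ≡ cost G φ + edgeSum G (far↔ p)
  cost-transposition = begin
    cost G ψ + edgeSum G (far↔ (suc p))
      ≡⟨ cong (_+ edgeSum G (far↔ (suc p))) (cost≡edgeSum G ψ) ⟩
    edgeSum G (minPos G ψ) + edgeSum G (far↔ (suc p))
      ≡⟨ edgeSum-+ G (minPos G ψ) (far↔ (suc p)) ⟨
    edgeSum G (λ u v → minPos G ψ u v + far↔ (suc p) u v)
      ≡⟨ edgeSum-cong G swap-weight ⟩
    edgeSum G (λ u v → minPos G φ u v + far↔ p u v)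
      ≡⟨ edgeSum-+ G (minPos G φ) (far↔ p) ⟩
    edgeSum G (minPos G φ) + edgeSum G (far↔ p)
      ≡⟨ cong (_+ edgeSum G (far↔ p)) (cost≡edgeSum G φ) ⟨
    cost G φ + edgeSum G (far↔ p) ∎
    where
    open ≡-Reasoning
    swap-weight : ∀ u v → toℕ u < toℕ v →
                  minPos G ψ u v + far↔ (suc p) u v ≡ minPos G φ u v + far↔ p u v
    swap-weight u v u<v =
      trans (cong (_+ far↔ (suc p) u v) (cong₂ _⊓_ (pos-ψ u) (pos-ψ v)))
            (transposeSuc-⊓ p (idx u) (idx v) (λ e → <-irrefl (cong toℕ (idx-injective e)) u<v))

  beyondDegree : Fin n → ℕ
  beyondDegree x = ∑[ v < n ] (𝟙 (adj G x v) * 𝟙 (suc p <ᵇ idx v))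

  idx-from : ∀ X → idx (from X) ≡ toℕ X
  idx-from X = cong toℕ (strictlyInverseˡ X)

  edgeSum-far↔ : ∀ X → edgeSum G (far↔ (toℕ X)) ≡ beyondDegree (from X)
  edgeSum-far↔ X = begin
    edgeSum G (far↔ (toℕ X))
      ≡⟨ edgeSum-symmetrise G (far (toℕ X)) ⟩
    ∑[ u < n ] ∑[ v < n ] (𝟙 (adj G u v) * far (toℕ X) u v)
      ≡⟨ ∑-pointMass _ (from X) (λ u u≢x → ∑-zero _ (λ v → far-off u v u≢x)) ⟩
    ∑[ v < n ] (𝟙 (adj G (from X) v) * far (toℕ X) (from X) v)
      ≡⟨ sum-cong-≗ (λ v → cong (𝟙 (adj G (from X) v) *_) (far-at v)) ⟩
    beyondDegree (from X) ∎
    where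
    open ≡-Reasoning
    far-off : ∀ u v → u ≢ from X → 𝟙 (adj G u v) * far (toℕ X) u v ≡ 0
    far-off u v u≢x =
      trans (cong (λ b → 𝟙 (adj G u v) * 𝟙 (b ∧ (suc p <ᵇ idx v)))
                  (≢⇒≡ᵇ-false (λ e → u≢x (idx-injective (trans e (sym (idx-from X)))))))
            (*-zeroʳ (𝟙 (adj G u v)))
    far-at : ∀ v → far (toℕ X) (from X) v ≡ 𝟙 (suc p <ᵇ idx v)
    far-at v rewrite idx-from X | ≡ᵇ-refl (toℕ X) = refl

  rightDegree-from : ∀ X → rightDegree G φ (from X) ≡ ∑[ v < n ] (𝟙 (adj G (from X) v) * 𝟙 (toℕ X <ᵇ idx v))
  rightDegree-from X rewrite rightDegree≡∑ G φ (from X) | idx-from X = refl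

  a b : Fin n
  a = from P
  b = from Q

  rightDegree-b≡edgeSum : rightDegree G φ b ≡ edgeSum G (far↔ (suc p))
  rightDegree-b≡edgeSum = begin
    rightDegree G φ b
      ≡⟨ rightDegree-from Q ⟩
    ∑[ v < n ] (𝟙 (adj G b v) * 𝟙 (toℕ Q <ᵇ idx v))
      ≡⟨ cong (λ q → ∑[ v < n ] (𝟙 (adj G b v) * 𝟙 (q <ᵇ idx v))) Q≡1+P ⟩
    beyondDegree b
      ≡⟨ edgeSum-far↔ Q ⟨
    edgeSum G (far↔ (toℕ Q))
      ≡⟨ cong (edgeSum G ∘ far↔) Q≡1+P ⟩
    edgeSum G (far↔ (suc p)) ∎
    where open ≡-Reasoning

  beyondDegree-a≤rightDegree : beyondDegree a ≤ rightDegree G φ a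
  beyondDegree-a≤rightDegree rewrite rightDegree-from P =
    ∑-mono-≤ (λ v → *-monoʳ-≤ (𝟙 (adj G a v)) (𝟙-suc-<ᵇ p (idx v)))

  rightDegree-step : Optimal G φ → rightDegree G φ b ≤ rightDegree G φ a
  rightDegree-step opt = +-cancelˡ-≤ (cost G φ) _ _ (begin
    cost G φ + rightDegree G φ b         ≤⟨ +-monoˡ-≤ _ (opt ψ) ⟩
    cost G ψ + rightDegree G φ b         ≡⟨ cong (cost G ψ +_) rightDegree-b≡edgeSum ⟩
    cost G ψ + edgeSum G (far↔ (suc p))  ≡⟨ cost-transposition ⟩
    cost G φ + edgeSum G (far↔ p)        ≡⟨ cong (cost G φ +_) (edgeSum-far↔ P) ⟩
    cost G φ + beyondDegree a            ≤⟨ +-monoʳ-≤ (cost G φ) beyondDegree-a≤rightDegree ⟩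
    cost G φ + rightDegree G φ a         ∎)
    where open ≤-Reasoning

lemma1 : ∀ (n : ℕ) (G : Graph n) (φ : Ordering n) → Optimal G φ →
         ∀ (i j : Fin n) → toℕ i ≤ toℕ j →
         rightDegree G φ (vertexAt φ j) ≤ rightDegree G φ (vertexAt φ i)
lemma1 n G φ opt = antitone-from-steps (λ i → rightDegree G φ (vertexAt φ i))
  (λ k l l≡1+k → AdjacentTransposition.rightDegree-step G φ k l l≡1+k opt)
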